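{- There is an absolute constant $C>0$ such that for every tree $T$ with maximum degree $\Delta=\Delta(T)$, $\overrightarrow{\chi_{u}}(T)\le C\Delta^3$; that is, $\overrightarrow{\chi_{u}}(T)=\mathcal{O}(\Delta^3)$.
   Context: All graphs are finite and simple. For a nonnegative integer $k$, $\mathbb{N}_k=\{1,2,\ldots,k\}$ (with $\mathbb{N}_0=\emptyset$). A universal labeling of a graph $G$ is a function $\ell: E(G)\to \mathbb{N}_k$ such that for every orientation of the edges of $G$ and every edge $uv\in E(G)$, the sum of $\ell(e)$ over the edges $e$ oriented into $u$ differs from the sum of $\ell(e)$ over the edges $e$ oriented into $v$. The universal labeling number $\overrightarrow{\chi_{u}}(G)$ is the minimum $k\ge 0$ such that $G$ has a universal labeling with labels from $\mathbb{N}_k$. -}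

module Defs where

open import Data.Nat using (ℕ; zero; suc; _+_; _*_; _^_; _≤_; _⊔_)
open import Data.Bool using (Bool; true; false; not; _∧_; if_then_else_)
open import Data.Fin using (Fin)
open import Data.List using (List; []; _∷_; _++_; length; map; foldr; allFin)
open import Data.Nat.ListAction using (sum)
open import Data.List.Relation.Unary.Unique.Propositional using (Unique)
open import Data.List.Relation.Unary.Linked using (Linked)
open import Data.Product using (Σ; _×_)
open import Relation.Binary.PropositionalEquality using (_≡_; _≢_)
open import Relation.Nullary using (¬_)

record Graph (n : ℕ) : Set where
  field
    adj    : Fin n → Fin n → Bool
    sym    : ∀ u v → adj u v ≡ adj v u
    irrefl : ∀ u → adj u u ≡ false
open Graph public

module _ {n : ℕ} (G : Graph n) where

  Adj : Fin n → Fin n → Set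
  Adj u v = adj G u v ≡ true

  deg : Fin n → ℕ
  deg v = sum (map (λ w → if adj G v w then 1 else 0) (allFin n))

  maxDeg : ℕ
  maxDeg = foldr _⊔_ 0 (map deg (allFin n))

  data Walk : Fin n → Fin n → Set where
    here : ∀ {v} → Walk v v
    step : ∀ {u w v} → Adj u w → Walk w v → Walk u v

  Connected : Set
  Connected = ∀ u v → Walk u v

  record Cycle : Set where
    field
      first  : Fin n
      rest   : List (Fin n)
      long   : 2 ≤ length rest
      uniq   : Unique (first ∷ rest)
      closed : Linked Adj (first ∷ rest ++ first ∷ [])

  Acyclic : Set
  Acyclic = ¬ Cycle

  IsTree : Set
  IsTree = Connected × Acyclic

  -- an edge labeling is given by a symmetric function on adjacent pairs;
  -- it uses labels from ℕ_k = {1,…,k}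
  record Labeling (k : ℕ) : Set where
    field
      lab      : Fin n → Fin n → ℕ
      lab-sym  : ∀ u v → Adj u v → lab u v ≡ lab v u
      lab-pos  : ∀ u v → Adj u v → 1 ≤ lab u v
      lab-le   : ∀ u v → Adj u v → lab u v ≤ k
  open Labeling public

  -- an orientation: for each edge {u,v}, exactly one of ori u v, ori v u
  -- is true; ori u v ≡ true means the edge is oriented from u into v
  record Orientation : Set where
    field
      ori      : Fin n → Fin n → Bool
      ori-anti : ∀ u v → Adj u v → ori u v ≡ not (ori v u)
  open Orientation public

  inSum : ∀ {k} → Labeling k → Orientation → Fin n → ℕ
  inSum ℓ o u =
    sum (map (λ w → if adj G w u ∧ ori o w u then lab ℓ w u else 0) (allFin n))

  IsUniversal : ∀ {k} → Labeling k → Set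
  IsUniversal ℓ = ∀ (o : Orientation) u v → Adj u v → inSum ℓ o u ≢ inSum ℓ o v

  HasUniversalLabeling : ℕ → Set
  HasUniversalLabeling k = Σ (Labeling k) IsUniversal

-- Root the tree and let the edge from a vertex p to its i-th child (0 ≤ i < Δ) carry the
-- label (Δ + i)·K or Δ + i according to the parity of the depth of p, where K = 4Δ².
-- In every orientation the in-sum at a vertex x is then a two-digit number in base K: one
-- digit sums the slots Δ + i of the child edges oriented into x, the other is the slot of
-- the parent edge if it is oriented into x (and 0 otherwise). Both digits are below
-- 2Δ² < K, and adjacent levels use opposite digits, so equal in-sums at a parent p and
-- its child c would force the children-digit of p to equal the parent-digit of c. That is
-- impossible: either the edge pc points into p, and the children-digit of p contains its
-- slot while the parent-digit of c is 0; or it points into c, and a sum of distinct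
-- slots of [Δ, 2Δ) other than the slot of pc cannot equal that slot, because two slots
-- already add up to at least 2Δ. The labels are at most 2Δ·K = 8Δ³.
-- The rooting itself comes from the non-backtracking walk from each vertex to a fixed root,
-- which is unique since two different ones would close a cycle.
module Submission where

open import Defs hiding (sym)
open import Data.Nat.Properties
open import Algebra.Properties.Semiring.Sum +-*-semiring
  using (sum; sum-syntax; sum-cong-≗; sum-replicate-zero; ∑-distrib-+; *-distribˡ-sum; *-distribʳ-sum)
open import Data.Bool using (Bool; true; false; not; _∧_; if_then_else_)
open import Data.Bool.Properties using (not-involutive)
open import Data.Empty using (⊥)
open import Data.Fin using (Fin; zero; suc) renaming (_<_ to _<ᶠ_)
import Data.Fin.Properties as Fin
open import Data.List using (List; []; _∷_; _++_; [_]; _ʳ++_; length; map; foldr; tabulate; allFin; last)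
open import Data.List.Membership.Propositional using (_∈_)
open import Data.List.Membership.Propositional.Properties using (∈-∃++; ∈-map⁺; ∈-allFin)
import Data.List.Properties as List
open import Data.List.Relation.Unary.Any using (here; there)
open import Data.List.Relation.Unary.All using ([]; _∷_)
import Data.List.Relation.Unary.All.Properties as All
open import Data.List.Relation.Unary.AllPairs using ([]; _∷_)
open import Data.List.Relation.Unary.Linked as Linked using (Linked; []; [-]; _∷_)
open import Data.List.Relation.Unary.Unique.Propositional using (Unique)
open import Data.List.Relation.Unary.Unique.Propositional.Properties using (Unique[x∷xs]⇒x∉xs)
open import Data.Maybe using (just)
open import Data.Nat using (ℕ; zero; suc; _+_; _*_; _^_; _≤_; _<_; _⊔_; z≤n; s≤s; NonZero; >-nonZero)
open import Data.Nat.DivMod using (_%_; [m+kn]%n≡m%n; m<n⇒m%n≡m)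
open import Data.Nat.ListAction using () renaming (sum to listSum)
open import Data.Nat.Tactic.RingSolver using (solve-∀)
open import Data.Product using (Σ; ∃; ∃₂; _×_; _,_; proj₁; proj₂)
open import Data.Sum as Sum using (_⊎_; inj₁; inj₂)
open import Data.Unit using (⊤; tt)
open import Function using (_∘_; id; case_of_)
open import Relation.Binary.Definitions using (tri<; tri≈; tri>)
open import Relation.Binary.PropositionalEquality
  using (_≡_; _≢_; refl; sym; trans; cong; cong₂; subst; module ≡-Reasoning)
open import Relation.Nullary using (¬_; Dec; yes; no; does; contradiction)
open import Relation.Nullary.Decidable using (dec-true; dec-false)

-- Finite sums and counting over Fin n

listSum-map-tabulate : ∀ {n} {A : Set} (f : A → ℕ) (g : Fin n → A) →
                       listSum (map f (tabulate g)) ≡ ∑[ i < n ] f (g i)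
listSum-map-tabulate {zero}  f g = refl
listSum-map-tabulate {suc n} f g = cong (f (g zero) +_) (listSum-map-tabulate f (g ∘ suc))

∈⇒≤foldr-⊔ : ∀ {m xs} → m ∈ xs → m ≤ foldr _⊔_ 0 xs
∈⇒≤foldr-⊔ {xs = x ∷ xs} (here refl) = m≤m⊔n x _
∈⇒≤foldr-⊔ {xs = x ∷ xs} (there m∈xs) = ≤-trans (∈⇒≤foldr-⊔ m∈xs) (m≤n⊔m x _)

∑-mono-≤ : ∀ {n} {f g : Fin n → ℕ} → (∀ i → f i ≤ g i) → sum f ≤ sum g
∑-mono-≤ {zero}  _   = z≤n
∑-mono-≤ {suc n} f≤g = +-mono-≤ (f≤g zero) (∑-mono-≤ (f≤g ∘ suc))

∑-mono-< : ∀ {n} {f g : Fin n → ℕ} → (∀ i → f i ≤ g i) → ∀ j → f j < g j → sum f < sum g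
∑-mono-< f≤g zero    fj<gj = +-mono-<-≤ fj<gj (∑-mono-≤ (f≤g ∘ suc))
∑-mono-< f≤g (suc j) fj<gj = +-mono-≤-< (f≤g zero) (∑-mono-< (f≤g ∘ suc) j fj<gj)

≤-∑ : ∀ {n} (f : Fin n → ℕ) i → f i ≤ sum f
≤-∑ f zero    = m≤m+n (f zero) _
≤-∑ f (suc i) = ≤-trans (≤-∑ (f ∘ suc) i) (m≤n+m _ (f zero))

∑-zero : ∀ {n} {f : Fin n → ℕ} → (∀ i → f i ≡ 0) → sum f ≡ 0
∑-zero {n} f≡0 = trans (sum-cong-≗ f≡0) (sum-replicate-zero n)

∑-single : ∀ {n} {f : Fin n → ℕ} j → (∀ i → i ≢ j → f i ≡ 0) → sum f ≡ f j
∑-single {f = f} zero    f≡0 = trans (cong (f zero +_) (∑-zero (λ i → f≡0 (suc i) λ ()))) (+-identityʳ _)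
∑-single {f = f} (suc j) f≡0 =
  cong₂ _+_ (f≡0 zero λ ()) (∑-single j (λ i i≢j → f≡0 (suc i) (i≢j ∘ Fin.suc-injective)))

∑-zero-single-or-≥ : ∀ {n} {f : Fin n → ℕ} L → (∀ i → f i ≡ 0 ⊎ L ≤ f i) →
                     sum f ≡ 0 ⊎ (∃ λ i → sum f ≡ f i × L ≤ f i) ⊎ L + L ≤ sum f
∑-zero-single-or-≥ {zero}          L f∈ = inj₁ refl
∑-zero-single-or-≥ {suc n} {f = f} L f∈ with f∈ zero | ∑-zero-single-or-≥ L (f∈ ∘ suc)
... | inj₁ f₀≡0 | inj₁ rest≡0          = inj₁ (cong₂ _+_ f₀≡0 rest≡0)
... | inj₁ f₀≡0 | inj₂ (inj₁ (i , rest≡fi , L≤fi)) = inj₂ (inj₁ (suc i , cong₂ _+_ f₀≡0 rest≡fi , L≤fi))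
... | inj₁ _    | inj₂ (inj₂ 2L≤rest)  = inj₂ (inj₂ (≤-trans 2L≤rest (m≤n+m _ (f zero))))
... | inj₂ L≤f₀ | inj₁ rest≡0          = inj₂ (inj₁ (zero , trans (cong (f zero +_) rest≡0) (+-identityʳ _) , L≤f₀))
... | inj₂ L≤f₀ | inj₂ (inj₁ (i , rest≡fi , L≤fi)) =
  inj₂ (inj₂ (subst (L + L ≤_) (cong (f zero +_) (sym rest≡fi)) (+-mono-≤ L≤f₀ L≤fi)))
... | inj₂ _    | inj₂ (inj₂ 2L≤rest)  = inj₂ (inj₂ (≤-trans 2L≤rest (m≤n+m _ (f zero))))

∑-≢-nonSummand : ∀ {n} {f : Fin n → ℕ} {L v} → (∀ i → f i ≡ 0 ⊎ L ≤ f i) → (∀ i → f i ≢ v) →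
     v ≢ 0 → v < L + L → sum f ≢ v
∑-≢-nonSummand {L = L} f∈ f≢v v≢0 v<2L ∑≡v with ∑-zero-single-or-≥ L f∈
... | inj₁ ∑≡0                  = v≢0 (trans (sym ∑≡v) ∑≡0)
... | inj₂ (inj₁ (i , ∑≡fi , _)) = f≢v i (trans (sym ∑≡fi) ∑≡v)
... | inj₂ (inj₂ 2L≤∑)          = <⇒≱ v<2L (subst (_ ≤_) ∑≡v 2L≤∑)

indicator : Bool → ℕ
indicator b = if b then 1 else 0

count : ∀ {n} → (Fin n → Bool) → ℕ
count P = sum (indicator ∘ P)

rank : ∀ {n} → (Fin n → Bool) → Fin n → ℕ
rank P c = count (λ w → P w ∧ does (w Fin.<? c))

module _ {n} {P : Fin n → Bool} where

  rank<count : ∀ {c} → P c ≡ true → rank P c < count P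
  rank<count {c} Pc = ∑-mono-< below c at-c
    where
    below : ∀ w → indicator (P w ∧ does (w Fin.<? c)) ≤ indicator (P w)
    below w with P w | does (w Fin.<? c)
    ... | false | _     = z≤n
    ... | true  | false = z≤n
    ... | true  | true  = ≤-refl
    at-c : indicator (P c ∧ does (c Fin.<? c)) < indicator (P c)
    at-c rewrite Pc | dec-false (c Fin.<? c) (Fin.<-irrefl refl) = s≤s z≤n

  rank-mono-< : ∀ {c₁ c₂} → P c₁ ≡ true → c₁ <ᶠ c₂ → rank P c₁ < rank P c₂
  rank-mono-< {c₁} {c₂} Pc₁ c₁<c₂ = ∑-mono-< below c₁ at-c₁
    where
    below : ∀ w → indicator (P w ∧ does (w Fin.<? c₁)) ≤ indicator (P w ∧ does (w Fin.<? c₂))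
    below w with P w | w Fin.<? c₁
    ... | false | _        = z≤n
    ... | true  | no w≮c₁  rewrite dec-false (w Fin.<? c₁) w≮c₁ = z≤n
    ... | true  | yes w<c₁
      rewrite dec-true (w Fin.<? c₁) w<c₁ | dec-true (w Fin.<? c₂) (Fin.<-trans w<c₁ c₁<c₂) = ≤-refl
    at-c₁ : indicator (P c₁ ∧ does (c₁ Fin.<? c₁)) < indicator (P c₁ ∧ does (c₁ Fin.<? c₂))
    at-c₁ rewrite Pc₁ | dec-false (c₁ Fin.<? c₁) (Fin.<-irrefl refl) | dec-true (c₁ Fin.<? c₂) c₁<c₂ = s≤s z≤n

  rank-injective : ∀ {c₁ c₂} → P c₁ ≡ true → P c₂ ≡ true → rank P c₁ ≡ rank P c₂ → c₁ ≡ c₂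
  rank-injective {c₁} {c₂} Pc₁ Pc₂ eq with Fin.<-cmp c₁ c₂
  ... | tri< c₁<c₂ _ _ = contradiction eq (<⇒≢ (rank-mono-< Pc₁ c₁<c₂))
  ... | tri≈ _ c₁≡c₂ _ = c₁≡c₂
  ... | tri> _ _ c₂<c₁ = contradiction (sym eq) (<⇒≢ (rank-mono-< Pc₂ c₂<c₁))

-- Two-digit numbers

digits-unique : ∀ {K r r′ q q′} → r < K → r′ < K → r + q * K ≡ r′ + q′ * K → r ≡ r′ × q ≡ q′
digits-unique {K} {r} {r′} {q} {q′} r<K r′<K eq = r≡r′ , *-cancelʳ-≡ q q′ K (+-cancelˡ-≡ r _ _ eq′)
  where
  instance
    K≢0 : NonZero K
    K≢0 = >-nonZero (≤-<-trans z≤n r<K)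
  open ≡-Reasoning
  r≡r′ : r ≡ r′
  r≡r′ = begin
    r                 ≡⟨ m<n⇒m%n≡m r<K ⟨
    r % K             ≡⟨ [m+kn]%n≡m%n r q K ⟨
    (r + q * K) % K   ≡⟨ cong (_% K) eq ⟩
    (r′ + q′ * K) % K ≡⟨ [m+kn]%n≡m%n r′ q′ K ⟩
    r′ % K            ≡⟨ m<n⇒m%n≡m r′<K ⟩
    r′                ∎
  eq′ : r + q * K ≡ r + q′ * K
  eq′ = trans eq (cong (_+ q′ * K) (sym r≡r′))

placeValue : ℕ → Bool → ℕ
placeValue K b = if b then K else 1

placeValue-bounds : ∀ {K} b → 1 ≤ K → 1 ≤ placeValue K b × placeValue K b ≤ K
placeValue-bounds true  1≤K = 1≤K , ≤-refl
placeValue-bounds false 1≤K = ≤-refl , 1≤K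

twoDigit-injective : ∀ {K} b {x y x′ y′} → x < K → y < K → x′ < K → y′ < K →
                     x * placeValue K b + y * placeValue K (not b) ≡ x′ * placeValue K b + y′ * placeValue K (not b) →
                     x ≡ x′
twoDigit-injective {K} true {x} {y} {x′} {y′} _ y<K _ y′<K eq =
  proj₂ (digits-unique {q = x} {q′ = x′} y<K y′<K (begin
    y + x * K       ≡⟨ +-comm y _ ⟩
    x * K + y       ≡⟨ cong (x * K +_) (*-identityʳ y) ⟨
    x * K + y * 1   ≡⟨ eq ⟩
    x′ * K + y′ * 1 ≡⟨ cong (x′ * K +_) (*-identityʳ y′) ⟩
    x′ * K + y′     ≡⟨ +-comm _ y′ ⟩
    y′ + x′ * K     ∎))
  where open ≡-Reasoning
twoDigit-injective {K} false {x} {y} {x′} {y′} x<K _ x′<K _ eq =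
  proj₁ (digits-unique {q = y} {q′ = y′} x<K x′<K (begin
    x + y * K       ≡⟨ cong (_+ y * K) (*-identityʳ x) ⟨
    x * 1 + y * K   ≡⟨ eq ⟩
    x′ * 1 + y′ * K ≡⟨ cong (_+ y′ * K) (*-identityʳ x′) ⟩
    x′ + y′ * K     ∎))
  where open ≡-Reasoning

double-square<4*square : ∀ d → 1 ≤ d → (d + d) * d < 4 * (d * d)
double-square<4*square d 1≤d = subst ((d + d) * d <_) (sym (split d)) (m<m+n _ positive)
  where
  split : ∀ e → 4 * (e * e) ≡ (e + e) * e + (e + e) * e
  split = solve-∀
  positive : 0 < (d + d) * d
  positive = *-mono-≤ (≤-trans 1≤d (m≤m+n d d)) 1≤d

double*4*square≡8*cube : ∀ d → (d + d) * (4 * (d * d)) ≡ 8 * d ^ 3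
double*4*square≡8*cube d = expanded d
  where
  expanded : ∀ e → (e + e) * (4 * (e * e)) ≡ 8 * (e * (e * (e * 1)))
  expanded = solve-∀

parity : ℕ → Bool
parity zero    = false
parity (suc k) = not (parity k)

-- Non-backtracking walks

module _ {A : Set} where

  NonBacktracking : List A → Set
  NonBacktracking (x ∷ xs@(_ ∷ z ∷ _)) = x ≢ z × NonBacktracking xs
  NonBacktracking _                    = ⊤

  NonBacktracking-tail : ∀ {x} (xs : List A) → NonBacktracking (x ∷ xs) → NonBacktracking xs
  NonBacktracking-tail []          _        = tt
  NonBacktracking-tail (_ ∷ [])    _        = tt
  NonBacktracking-tail (_ ∷ _ ∷ _) (_ , nb) = nb

  Diverge : List A → List A → Set
  Diverge (x ∷ _) (y ∷ _) = x ≢ y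
  Diverge _       _       = ⊤

  Linked-++⁻ˡ : ∀ {R : A → A → Set} xs {ys} → Linked R (xs ++ ys) → Linked R xs
  Linked-++⁻ˡ []           _            = []
  Linked-++⁻ˡ (x ∷ [])     _            = [-]
  Linked-++⁻ˡ (x ∷ y ∷ xs) (Rxy ∷ Rys) = Rxy ∷ Linked-++⁻ˡ (y ∷ xs) Rys

  Unique-++⁻ : ∀ (xs : List A) {x ys} → Unique (xs ++ x ∷ ys) → Unique (x ∷ xs)
  Unique-++⁻ []       _ = [] ∷ []
  Unique-++⁻ (y ∷ xs) (y∉ ∷ u) with Unique-++⁻ xs u | All.++⁻ xs y∉
  ... | x∉xs ∷ uxs | y∉xs , y≢x ∷ _ = (y≢x ∘ sym ∷ x∉xs) ∷ y∉xs ∷ uxs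

  Unique-ʳ++⁻ʳ : ∀ (xs : List A) {ys} → Unique (xs ʳ++ ys) → Unique ys
  Unique-ʳ++⁻ʳ []       u = u
  Unique-ʳ++⁻ʳ (x ∷ xs) u with Unique-ʳ++⁻ʳ xs u
  ... | _ ∷ uys = uys

  ∈-ʳ++-¬Unique : ∀ {v} (xs : List A) {ys} → v ∈ xs → v ∈ ys → ¬ Unique (xs ʳ++ ys)
  ∈-ʳ++-¬Unique (x ∷ xs) (here refl) v∈ys u = Unique[x∷xs]⇒x∉xs (Unique-ʳ++⁻ʳ xs u) v∈ys
  ∈-ʳ++-¬Unique (x ∷ xs) (there v∈xs) v∈ys = ∈-ʳ++-¬Unique xs v∈xs (there v∈ys)

  last-∈ : ∀ {v} (xs : List A) → last xs ≡ just v → v ∈ xs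
  last-∈ (x ∷ [])     refl = here refl
  last-∈ (x ∷ y ∷ xs) eq   = there (last-∈ (y ∷ xs) eq)

module _ {n} (G : Graph n) where

  open import Data.List.Membership.DecPropositional (Fin._≟_ {n}) using (_∈?_)

  adj-sym : ∀ {u v} → Adj G u v → Adj G v u
  adj-sym {u} {v} u~v = trans (Graph.sym G v u) u~v

  adj-irrefl : ∀ {u} → ¬ Adj G u u
  adj-irrefl {u} u~u with () ← trans (sym (irrefl G u)) u~u

  deg≡count : ∀ v → deg G v ≡ count (adj G v)
  deg≡count v = listSum-map-tabulate (indicator ∘ adj G v) id

  deg≤maxDeg : ∀ v → deg G v ≤ maxDeg G
  deg≤maxDeg v = ∈⇒≤foldr-⊔ (∈-map⁺ (deg G) (∈-allFin v))

  count-adj≤maxDeg : ∀ v → count (adj G v) ≤ maxDeg G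
  count-adj≤maxDeg v = subst (_≤ maxDeg G) (deg≡count v) (deg≤maxDeg v)

  adj⇒1≤maxDeg : ∀ {u v} → Adj G u v → 1 ≤ maxDeg G
  adj⇒1≤maxDeg {u} {v} u~v =
    ≤-trans (subst (λ b → indicator b ≤ count (adj G u)) u~v (≤-∑ _ v)) (count-adj≤maxDeg u)

  ∑≤M*maxDeg : ∀ {f : Fin n → ℕ} {M} x → (∀ w → f w ≤ M * indicator (adj G x w)) → sum f ≤ M * maxDeg G
  ∑≤M*maxDeg {f} {M} x f≤ = begin
    sum f                                  ≤⟨ ∑-mono-≤ f≤ ⟩
    sum (λ w → M * indicator (adj G x w))  ≡⟨ *-distribˡ-sum M (indicator ∘ adj G x) ⟨
    M * count (adj G x)                    ≤⟨ *-monoʳ-≤ M (count-adj≤maxDeg x) ⟩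
    M * maxDeg G                           ∎
    where open ≤-Reasoning

  ReducedWalk : List (Fin n) → Set
  ReducedWalk xs = Linked (Adj G) xs × NonBacktracking xs

  ReducedWalk-tail : ∀ {x} xs → ReducedWalk (x ∷ xs) → ReducedWalk xs
  ReducedWalk-tail xs (linked , nb) = Linked.tail linked , NonBacktracking-tail xs nb

  closedReducedWalk⇒Cycle : ∀ x pre post → ReducedWalk (x ∷ pre ++ x ∷ post) → Unique (pre ++ x ∷ post) → Cycle G
  closedReducedWalk⇒Cycle x pre post (linked , nb) u = record
    { first  = x
    ; rest   = pre
    ; long   = long pre linked nb
    ; uniq   = Unique-++⁻ pre u
    ; closed = Linked-++⁻ˡ (x ∷ pre ++ [ x ]) (subst (Linked (Adj G)) (sym (List.++-assoc (x ∷ pre) [ x ] post)) linked)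
    }
    where
    long : ∀ pre → Linked (Adj G) (x ∷ pre ++ x ∷ post) → NonBacktracking (x ∷ pre ++ x ∷ post) → 2 ≤ length pre
    long []          (x~x ∷ _) _          = contradiction x~x adj-irrefl
    long (_ ∷ [])    _         (x≢x , _)  = contradiction refl x≢x
    long (_ ∷ _ ∷ _) _         _          = s≤s (s≤s z≤n)

  acyclic⇒reducedWalk-unique : Acyclic G → ∀ xs → ReducedWalk xs → Unique xs
  acyclic⇒reducedWalk-unique acyclic []       _ = []
  acyclic⇒reducedWalk-unique acyclic (x ∷ xs) w
    with acyclic⇒reducedWalk-unique acyclic xs (ReducedWalk-tail xs w) | x ∈? xs
  ... | u | no x∉xs  = All.¬Any⇒All¬ xs x∉xs ∷ u
  ... | u | yes x∈xs with pre , post , refl ← ∈-∃++ x∈xs =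
    contradiction (closedReducedWalk⇒Cycle x pre post w u) acyclic

  ʳ++-reducedWalk : ∀ y xs ys → ReducedWalk (y ∷ xs) → ReducedWalk (y ∷ ys) → Diverge xs ys →
                    ReducedWalk (xs ʳ++ y ∷ ys)
  ʳ++-reducedWalk y []       ys _ w _ = w
  ʳ++-reducedWalk y (x ∷ xs) ys (y~x ∷ linkedˣ , nbˣ) (linkedʸ , nbʸ) x≢ys =
    ʳ++-reducedWalk x xs (y ∷ ys)
      (linkedˣ , NonBacktracking-tail (x ∷ xs) nbˣ) (adj-sym y~x ∷ linkedʸ , nb ys nbʸ x≢ys) (diverge xs nbˣ)
    where
    nb : ∀ ys → NonBacktracking (y ∷ ys) → Diverge (x ∷ xs) ys → NonBacktracking (x ∷ y ∷ ys)
    nb []       _   _   = tt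
    nb (z ∷ ys) nbʸ x≢z = x≢z , nbʸ
    diverge : ∀ xs → NonBacktracking (y ∷ x ∷ xs) → Diverge xs (y ∷ ys)
    diverge []      _         = tt
    diverge (_ ∷ _) (y≢z , _) = y≢z ∘ sym

  module _ (r : Fin n) where

    RootWalk : Fin n → List (Fin n) → Set
    RootWalk x t = ReducedWalk (x ∷ t) × last (x ∷ t) ≡ just r

    RootWalk-tail : ∀ {x y} t → RootWalk x (y ∷ t) → RootWalk y t
    RootWalk-tail t (w , end) = ReducedWalk-tail (_ ∷ t) w , end

    walk⇒RootWalk : ∀ {x} → Walk G x r → ∃ (RootWalk x)
    walk⇒RootWalk here = [] , ([-] , tt) , refl
    walk⇒RootWalk {x} (step {w = y} x~y walk) with walk⇒RootWalk walk
    ... | []    , _               , end = y ∷ [] , (x~y ∷ [-] , tt) , end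
    ... | z ∷ t , w@(linked , nb) , end with x Fin.≟ z
    ...   | yes refl = t , ReducedWalk-tail (z ∷ t) w , end
    ...   | no x≢z   = y ∷ z ∷ t , (x~y ∷ linked , x≢z , nb) , end

    RootWalk-root : ∀ {z t} → Acyclic G → ¬ RootWalk r (z ∷ t)
    RootWalk-root {z} {t} acyclic (w , end) =
      Unique[x∷xs]⇒x∉xs (acyclic⇒reducedWalk-unique acyclic _ w) (last-∈ (z ∷ t) end)

    -- Two different reduced walks from x to r glue at x into a reduced walk visiting r twice.
    RootWalk-unique : Acyclic G → ∀ {x} t₁ t₂ → RootWalk x t₁ → RootWalk x t₂ → t₁ ≡ t₂
    RootWalk-unique acyclic []      []      _          _          = refl
    RootWalk-unique acyclic []      (_ ∷ _) (_ , refl) w₂         = contradiction w₂ (RootWalk-root acyclic)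
    RootWalk-unique acyclic (_ ∷ _) []      w₁         (_ , refl) = contradiction w₁ (RootWalk-root acyclic)
    RootWalk-unique acyclic {x} (y ∷ t₁) (z ∷ t₂) w₁@(rw₁ , end₁) w₂@(rw₂ , end₂) with y Fin.≟ z
    ... | yes refl = cong (y ∷_) (RootWalk-unique acyclic t₁ t₂ (RootWalk-tail t₁ w₁) (RootWalk-tail t₂ w₂))
    ... | no y≢z   = contradiction
      (acyclic⇒reducedWalk-unique acyclic _ (ʳ++-reducedWalk x (y ∷ t₁) (z ∷ t₂) rw₁ rw₂ y≢z))
      (∈-ʳ++-¬Unique (y ∷ t₁) (last-∈ (y ∷ t₁) end₁) (last-∈ (x ∷ z ∷ t₂) end₂))

-- Rooted trees

record Rooting {n} (G : Graph n) : Set₁ where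
  field
    Parent        : Fin n → Fin n → Set
    parent?       : ∀ p c → Dec (Parent p c)
    depth         : Fin n → ℕ
    parent⇒adj    : ∀ {p c} → Parent p c → Adj G p c
    parent-unique : ∀ {p q c} → Parent p c → Parent q c → p ≡ q
    parent-depth  : ∀ {p c} → Parent p c → depth c ≡ suc (depth p)
    adj⇒parent    : ∀ {u v} → Adj G u v → Parent u v ⊎ Parent v u

module _ {n} {G : Graph n} (connected : Connected G) (acyclic : Acyclic G) (r : Fin n) where

  pathToRoot : Fin n → List (Fin n)
  pathToRoot x = proj₁ (walk⇒RootWalk G r (connected x r))

  pathToRoot-RootWalk : ∀ x → RootWalk G r x (pathToRoot x)
  pathToRoot-RootWalk x = proj₂ (walk⇒RootWalk G r (connected x r))

  pathToRoot-unique : ∀ {x} t → RootWalk G r x t → t ≡ pathToRoot x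
  pathToRoot-unique {x} t w = RootWalk-unique G r acyclic t (pathToRoot x) w (pathToRoot-RootWalk x)

  PathParent : Fin n → Fin n → Set
  PathParent p c = pathToRoot c ≡ p ∷ pathToRoot p

  adj⇒PathParent : ∀ {u v} → Adj G u v → PathParent u v ⊎ PathParent v u
  adj⇒PathParent {u} {v} u~v =
    Sum.map₂ (sym ∘ pathToRoot-unique _) (extend (pathToRoot v) (pathToRoot-RootWalk v))
    where
    extend : ∀ t → RootWalk G r v t → t ≡ u ∷ pathToRoot u ⊎ RootWalk G r u (v ∷ t)
    extend []      (_ , end) = inj₂ ((u~v ∷ [-] , tt) , end)
    extend (w ∷ t) walk@((linked , nb) , end) with u Fin.≟ w
    ... | yes refl = inj₁ (cong (u ∷_) (pathToRoot-unique t (RootWalk-tail G r t walk)))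
    ... | no u≢w   = inj₂ ((u~v ∷ linked , u≢w , nb) , end)

  pathRooting : Rooting G
  pathRooting = record
    { Parent        = PathParent
    ; parent?       = λ p c → List.≡-dec Fin._≟_ (pathToRoot c) (p ∷ pathToRoot p)
    ; depth         = length ∘ pathToRoot
    ; parent⇒adj    = λ {p} {c} pc →
        adj-sym G (Linked.head (subst (Linked (Adj G) ∘ (c ∷_)) pc (proj₁ (proj₁ (pathToRoot-RootWalk c)))))
    ; parent-unique = λ pc qc → List.∷-injectiveˡ (trans (sym pc) qc)
    ; parent-depth  = cong length
    ; adj⇒parent    = adj⇒PathParent
    }

tree⇒rooting : ∀ {n} {G : Graph n} → IsTree G → Rooting G
tree⇒rooting {zero} _ = record
  { Parent        = λ _ _ → ⊥
  ; parent?       = λ _ _ → no id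
  ; depth         = λ _ → 0
  ; parent⇒adj    = λ ()
  ; parent-unique = λ ()
  ; parent-depth  = λ ()
  ; adj⇒parent    = λ { {()} }
  }
tree⇒rooting {suc n} (connected , acyclic) = pathRooting connected acyclic zero

-- The labeling of a rooted tree

module RootedLabeling {n} {G : Graph n} (R : Rooting G) where
  open Rooting R

  parent-asym : ∀ {u v} → Parent u v → ¬ Parent v u
  parent-asym uv vu = <⇒≢ (m<n⇒m<1+n (n<1+n _)) (trans (parent-depth uv) (cong suc (parent-depth vu)))

  isParent : Fin n → Fin n → Bool
  isParent p c = does (parent? p c)

  level : Fin n → Bool
  level x = parity (depth x)

  level-child : ∀ {p c} → Parent p c → level c ≡ not (level p)
  level-child pc = cong parity (parent-depth pc)

  D K : ℕ
  D = maxDeg G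
  K = 4 * (D * D)

  1≤D : ∀ {p c} → Parent p c → 1 ≤ D
  1≤D pc = adj⇒1≤maxDeg G (parent⇒adj pc)

  1≤K : 1 ≤ D → 1 ≤ K
  1≤K 1≤D = *-mono-≤ {1} {4} (s≤s z≤n) (*-mono-≤ 1≤D 1≤D)

  weight : Bool → ℕ
  weight = placeValue K

  slot : Fin n → Fin n → ℕ
  slot p c = D + rank (isParent p) c

  slot-< : ∀ {p c} → Parent p c → slot p c < D + D
  slot-< {p} {c} pc = +-monoʳ-< D (<-≤-trans (rank<count {P = isParent p} (dec-true (parent? p c) pc)) children≤D)
    where
    child⇒adj : ∀ w → indicator (isParent p w) ≤ indicator (adj G p w)
    child⇒adj w with parent? p w
    ... | yes pw rewrite parent⇒adj pw = ≤-refl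
    ... | no _  = z≤n
    children≤D : count (isParent p) ≤ D
    children≤D = ≤-trans (∑-mono-≤ child⇒adj) (count-adj≤maxDeg G p)

  slot≢0 : ∀ {p c} → Parent p c → slot p c ≢ 0
  slot≢0 pc = m<n⇒n≢0 (≤-trans (1≤D pc) (m≤m+n D _))

  slot-injective : ∀ {p c₁ c₂} → Parent p c₁ → Parent p c₂ → slot p c₁ ≡ slot p c₂ → c₁ ≡ c₂
  slot-injective {p} {c₁} {c₂} pc₁ pc₂ eq =
    rank-injective (dec-true (parent? p c₁) pc₁) (dec-true (parent? p c₂) pc₂) (+-cancelˡ-≡ D _ _ eq)

  downSlot : Fin n → Fin n → ℕ
  downSlot p c = if isParent p c then slot p c else 0

  downSlot-parent : ∀ {p c} → Parent p c → downSlot p c ≡ slot p c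
  downSlot-parent {p} {c} pc rewrite dec-true (parent? p c) pc = refl

  downSlot-¬parent : ∀ {p c} → ¬ Parent p c → downSlot p c ≡ 0
  downSlot-¬parent {p} {c} ¬pc rewrite dec-false (parent? p c) ¬pc = refl

  downSlot-≤ : ∀ p c → downSlot p c ≤ (D + D) * indicator (adj G p c)
  downSlot-≤ p c with parent? p c
  ... | yes pc rewrite parent⇒adj pc = ≤-trans (<⇒≤ (slot-< pc)) (≤-reflexive (sym (*-identityʳ _)))
  ... | no _   = z≤n

  downSlot-level : ∀ p c → downSlot p c * weight (level p) ≡ downSlot p c * weight (not (level c))
  downSlot-level p c with parent? p c
  ... | yes pc = cong (λ b → slot p c * weight b) (sym (trans (cong not (level-child pc)) (not-involutive _)))
  ... | no _   = refl

  -- On an edge exactly one of the two terms is nonzero: the one whose first vertex is the parent.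
  label : Fin n → Fin n → ℕ
  label u v = downSlot u v * weight (level u) + downSlot v u * weight (level v)

  label-sym : ∀ u v → label u v ≡ label v u
  label-sym u v = +-comm (downSlot u v * weight (level u)) _

  label-parent : ∀ {p c} → Parent p c → label p c ≡ slot p c * weight (level p)
  label-parent {p} {c} pc rewrite downSlot-parent pc | downSlot-¬parent (parent-asym pc) = +-identityʳ _

  label-edge : ∀ {u v} → Adj G u v → ∃₂ λ p c → Parent p c × label u v ≡ slot p c * weight (level p)
  label-edge {u} {v} u~v with adj⇒parent u~v
  ... | inj₁ uv = u , v , uv , label-parent uv
  ... | inj₂ vu = v , u , vu , trans (label-sym u v) (label-parent vu)

  label-bounds : ∀ {u v} → Adj G u v → 1 ≤ label u v × label u v ≤ 8 * D ^ 3
  label-bounds u~v with label-edge u~v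
  ... | p , c , pc , eq rewrite eq =
    *-mono-≤ (≤-trans (1≤D pc) (m≤m+n D _)) (proj₁ weight-bounds) ,
    ≤-trans (*-mono-≤ (<⇒≤ (slot-< pc)) (proj₂ weight-bounds)) (≤-reflexive (double*4*square≡8*cube D))
    where
    weight-bounds = placeValue-bounds (level p) (1≤K (1≤D pc))

  labeling : Labeling G (8 * maxDeg G ^ 3)
  labeling = record
    { lab     = label
    ; lab-sym = λ u v _ → label-sym u v
    ; lab-pos = λ _ _ → proj₁ ∘ label-bounds
    ; lab-le  = λ _ _ → proj₂ ∘ label-bounds
    }

  module _ (o : Orientation G) where

    into : Fin n → Fin n → Bool
    into w x = adj G w x ∧ ori o w x

    into-flip : ∀ {u v} → Adj G u v → into v u ≡ not (into u v)
    into-flip {u} {v} u~v rewrite u~v | adj-sym G u~v = ori-anti o v u (adj-sym G u~v)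

    parentTerm childTerm : Fin n → Fin n → ℕ
    parentTerm x w = if into w x then downSlot w x else 0
    childTerm  x w = if into w x then downSlot x w else 0

    fromParent fromChildren : Fin n → ℕ
    fromParent   x = sum (parentTerm x)
    fromChildren x = sum (childTerm x)

    inSum-digits : ∀ x → inSum G labeling o x ≡ fromChildren x * weight (level x) + fromParent x * weight (not (level x))
    inSum-digits x = begin
      inSum G labeling o x
        ≡⟨ listSum-map-tabulate (λ w → if into w x then label w x else 0) id ⟩
      sum (λ w → if into w x then label w x else 0)
        ≡⟨ sum-cong-≗ term-digits ⟩
      sum (λ w → childTerm x w * weight (level x) + parentTerm x w * weight (not (level x)))
        ≡⟨ ∑-distrib-+ (λ w → childTerm x w * weight (level x)) _ ⟩
      sum (λ w → childTerm x w * weight (level x)) + sum (λ w → parentTerm x w * weight (not (level x)))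
        ≡⟨ cong₂ _+_ (*-distribʳ-sum (weight (level x)) (childTerm x))
                     (*-distribʳ-sum (weight (not (level x))) (parentTerm x)) ⟨
      fromChildren x * weight (level x) + fromParent x * weight (not (level x))
        ∎
      where
      open ≡-Reasoning
      term-digits : ∀ w → (if into w x then label w x else 0) ≡
                          childTerm x w * weight (level x) + parentTerm x w * weight (not (level x))
      term-digits w with into w x
      ... | false = refl
      ... | true  = trans (+-comm (downSlot w x * weight (level w)) _)
                          (cong (downSlot x w * weight (level x) +_) (downSlot-level w x))

    digits<K : 1 ≤ D → ∀ x → fromChildren x < K × fromParent x < K
    digits<K 1≤D x =
      ≤-<-trans (∑≤M*maxDeg G {M = D + D} x childTerm≤) (double-square<4*square D 1≤D) ,
      ≤-<-trans (∑≤M*maxDeg G {M = D + D} x parentTerm≤) (double-square<4*square D 1≤D)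
      where
      if-≤ : ∀ b {v} → (if b then v else 0) ≤ v
      if-≤ true  = ≤-refl
      if-≤ false = z≤n
      childTerm≤ : ∀ w → childTerm x w ≤ (D + D) * indicator (adj G x w)
      childTerm≤ w = ≤-trans (if-≤ (into w x)) (downSlot-≤ x w)
      parentTerm≤ : ∀ w → parentTerm x w ≤ (D + D) * indicator (adj G x w)
      parentTerm≤ w = ≤-trans (if-≤ (into w x))
        (subst (λ b → downSlot w x ≤ (D + D) * indicator b) (Graph.sym G w x) (downSlot-≤ w x))

    fromParent-child : ∀ {p c} → Parent p c → fromParent c ≡ (if into p c then slot p c else 0)
    fromParent-child {p} {c} pc =
      trans (∑-single {f = parentTerm c} p others) (cong (λ v → if into p c then v else 0) (downSlot-parent pc))
      where
      others : ∀ w → w ≢ p → parentTerm c w ≡ 0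
      others w w≢p with into w c
      ... | false = refl
      ... | true  = downSlot-¬parent (λ wc → w≢p (parent-unique wc pc))

    fromChildren≢incomingSlot : ∀ {p c} → Parent p c → fromChildren p ≢ (if into p c then slot p c else 0)
    fromChildren≢incomingSlot {p} {c} pc with into p c in p→c
    ... | true  = ∑-≢-nonSummand zero-or-≥D ≢slot (slot≢0 pc) (slot-< pc)
      where
      c↛p : into c p ≡ false
      c↛p = trans (into-flip (parent⇒adj pc)) (cong not p→c)
      zero-or-≥D : ∀ w → childTerm p w ≡ 0 ⊎ D ≤ childTerm p w
      zero-or-≥D w with into w p | parent? p w
      ... | false | _     = inj₁ refl
      ... | true  | no _  = inj₁ refl
      ... | true  | yes _ = inj₂ (m≤m+n D _)
      ≢slot : ∀ w → childTerm p w ≢ slot p c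
      ≢slot w with into w p in w→p | parent? p w
      ... | false | _      = slot≢0 pc ∘ sym
      ... | true  | no _   = slot≢0 pc ∘ sym
      ... | true  | yes pw = λ eq →
        case trans (sym (subst (λ z → into z p ≡ true) (slot-injective pw pc eq) w→p)) c↛p of λ ()
    ... | false = λ ∑≡0 →
      slot≢0 pc (n≤0⇒n≡0 (subst (slot p c ≤_) ∑≡0 (subst (_≤ fromChildren p) term-c (≤-∑ _ c))))
      where
      term-c : childTerm p c ≡ slot p c
      term-c rewrite into-flip (parent⇒adj pc) | p→c = downSlot-parent pc

    parent≢child : ∀ {p c} → Parent p c → inSum G labeling o p ≢ inSum G labeling o c
    parent≢child {p} {c} pc eq = fromChildren≢incomingSlot pc (trans digitsEqual (fromParent-child pc))
      where
      open ≡-Reasoning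
      p<K = digits<K (1≤D pc) p
      c<K = digits<K (1≤D pc) c
      digitsEqual : fromChildren p ≡ fromParent c
      digitsEqual = twoDigit-injective (level p) (proj₁ p<K) (proj₂ p<K) (proj₂ c<K) (proj₁ c<K) (begin
        fromChildren p * weight (level p) + fromParent p * weight (not (level p))
          ≡⟨ inSum-digits p ⟨
        inSum G labeling o p
          ≡⟨ eq ⟩
        inSum G labeling o c
          ≡⟨ inSum-digits c ⟩
        fromChildren c * weight (level c) + fromParent c * weight (not (level c))
          ≡⟨ +-comm (fromChildren c * weight (level c)) _ ⟩
        fromParent c * weight (not (level c)) + fromChildren c * weight (level c)
          ≡⟨ cong (λ b → fromParent c * weight (not b) + fromChildren c * weight b) (level-child pc) ⟩
        fromParent c * weight (not (not (level p))) + fromChildren c * weight (not (level p))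
          ≡⟨ cong (λ b → fromParent c * weight b + fromChildren c * weight (not (level p))) (not-involutive (level p)) ⟩
        fromParent c * weight (level p) + fromChildren c * weight (not (level p))
          ∎)

  universal : IsUniversal G labeling
  universal o u v u~v with adj⇒parent u~v
  ... | inj₁ uv = parent≢child o uv
  ... | inj₂ vu = parent≢child o vu ∘ sym

rooting⇒universalLabeling : ∀ {n} {G : Graph n} → Rooting G → HasUniversalLabeling G (8 * maxDeg G ^ 3)
rooting⇒universalLabeling R = labeling , universal
  where open RootedLabeling R

mainTheorem2 : Σ ℕ (λ C → (1 ≤ C) × (∀ (n : ℕ) (T : Graph n) → IsTree T → HasUniversalLabeling T (C * maxDeg T ^ 3)))
mainTheorem2 = 8 , s≤s z≤n , λ _ _ → rooting⇒universalLabeling ∘ tree⇒rooting
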